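{- Let $q=p^e$, $k\ge1$, and let $E$ be an elliptic curve over $R_k=\mathbb F_q[\varepsilon]$, $\varepsilon^k=0$. Let $P,Q\in E^\infty$ with $v(P)=v(Q)=m<\infty$, and let $c_P,c_Q\in\mathbb F_q$ be such that $P_x\equiv c_P\varepsilon^m$ and $Q_x\equiv c_Q\varepsilon^m\pmod{\varepsilon^{m+1}}$. Then $(P+Q)_x\equiv(c_P+c_Q)\varepsilon^m\pmod{\varepsilon^{m+1}}$.
   Context: An elliptic curve $E$ over $R_k$ is the set of points of $\mathbb P^2(R_k)$ satisfying $y^2z+a_1xyz+a_3yz^2=x^3+a_2x^2z+a_4xz^2+a_6z^3$ with $a_i\in R_k$ and unit discriminant, with its group law (identity $(0:1:0)$). $E^\infty$ is the kernel of reduction modulo $(\varepsilon)$; each $P\in E^\infty$ has a unique representative $(P_x:1:P_z)$ with $P_x,P_z\in(\varepsilon)$. For $0\ne r\in R_k$, $v(r)$ is the largest $i\ge0$ with $\varepsilon^i\mid r$; $v(0)=\infty$; $v(P)=v(P_x)$ for $P\in E^\infty$. -}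

module Defs where

open import Level using (0ℓ)
open import Data.Nat as ℕ using (ℕ; zero; suc; _≤_)
open import Data.Nat.Primality using (Prime)
open import Data.Fin using (Fin)
open import Data.Vec using (Vec; []; _∷_; zipWith; map; replicate)
open import Data.Product using (Σ; _×_; _,_)
open import Relation.Binary.PropositionalEquality using (_≡_; _≢_)
open import Algebra.Core using (Op₁; Op₂)
open import Algebra.Structures using (IsCommutativeRing)
open import Function.Bundles using (_↔_)

-- A finite field F_q with q = p ^ e  (p prime, e ≥ 1).
-- Equality is propositional equality; _⁻¹ is an inverse on nonzero elements
-- (its value at 0# is irrelevant).

record FiniteField : Set₁ where
  infixl 6 _+_
  infixl 7 _*_
  field
    Carrier  : Set
    _+_ _*_  : Op₂ Carrier
    -_       : Op₁ Carrier
    0# 1#    : Carrier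
    _⁻¹      : Op₁ Carrier
    isCommutativeRing : IsCommutativeRing _≡_ _+_ _*_ -_ 0# 1#
    0≢1      : 0# ≢ 1#
    ⁻¹-inverse : ∀ x → x ≢ 0# → x * (x ⁻¹) ≡ 1#
    p e      : ℕ
    p-prime  : Prime p
    e≥1      : 1 ≤ e
    enumeration : Carrier ↔ Fin (p ℕ.^ e)

-- R_k = F_q[ε]/(ε^k), elements are coefficient vectors (c₀, …, c_{k-1})
-- representing c₀ + c₁ ε + … + c_{k-1} ε^{k-1}.

module TruncPoly (𝔽 : FiniteField) (k : ℕ) where
  open FiniteField 𝔽

  R : Set
  R = Vec Carrier k

  infixl 6 _⊕_ _⊖_
  infixl 7 _⊗_

  dropLast : ∀ {n} → Vec Carrier (suc n) → Vec Carrier n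
  dropLast (x ∷ [])     = []
  dropLast (x ∷ y ∷ ys) = x ∷ dropLast (y ∷ ys)

  -- truncated product: (a + ε A)·B = a·B + ε (A · (B mod ε^{n}))
  mulV : ∀ {n} → Vec Carrier n → Vec Carrier n → Vec Carrier n
  mulV []       []       = []
  mulV (a ∷ as) (b ∷ bs) =
    zipWith _+_ (map (a *_) (b ∷ bs)) (0# ∷ mulV as (dropLast (b ∷ bs)))

  constV : ∀ {n} → Carrier → Vec Carrier n
  constV {zero}  c = []
  constV {suc n} c = c ∷ replicate n 0#

  epsV : ∀ {n} → Vec Carrier n
  epsV {zero}        = []
  epsV {suc zero}    = 0# ∷ []
  epsV {suc (suc n)} = 0# ∷ 1# ∷ replicate n 0#

  _⊕_ : R → R → R
  _⊕_ = zipWith _+_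

  ⊝_ : R → R
  ⊝_ = map -_

  _⊖_ : R → R → R
  x ⊖ y = x ⊕ (⊝ y)

  _⊗_ : R → R → R
  _⊗_ = mulV

  0R 1R : R
  0R = constV 0#
  1R = constV 1#

  const : Carrier → R
  const = constV

  ε : R
  ε = epsV

  ε^_ : ℕ → R
  ε^ zero  = 1R
  ε^ suc n = ε ⊗ (ε^ n)

  ι : ℕ → R
  ι zero    = 0R
  ι (suc n) = 1R ⊕ ι n

  _∣R_ : R → R → Set
  a ∣R b = Σ R (λ c → b ≡ a ⊗ c)

  _≡_[mod-ε^_] : R → R → ℕ → Set
  a ≡ b [mod-ε^ n ] = (ε^ n) ∣R (a ⊖ b)

  IsUnit : R → Set
  IsUnit u = Σ R (λ w → u ⊗ w ≡ 1R)

  HasValuation : R → ℕ → Set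
  HasValuation r m = ((ε^ m) ∣R r) × (∀ i → (ε^ i) ∣R r → i ≤ m)

  -- inverse of a unit u = u₀(1 - n) with n nilpotent:
  --   u⁻¹ = u₀⁻¹ (1 + n + … + n^{k-1})
  lead : R → Carrier
  lead r = leadV r
    where
    leadV : ∀ {n} → Vec Carrier n → Carrier
    leadV []      = 0#
    leadV (x ∷ _) = x

  geom : R → ℕ → R
  geom n zero    = 0R
  geom n (suc j) = 1R ⊕ (n ⊗ geom n j)

  invR : R → R
  invR u = const c ⊗ geom (1R ⊖ (const c ⊗ u)) k
    where c = lead u ⁻¹

  disc : R → R → R → R → R → R
  disc a₁ a₂ a₃ a₄ a₆ =
    ⊝ (b₂ ⊗ b₂ ⊗ b₈) ⊖ ι 8 ⊗ b₄ ⊗ b₄ ⊗ b₄ ⊖ ι 27 ⊗ b₆ ⊗ b₆ ⊕ ι 9 ⊗ b₂ ⊗ b₄ ⊗ b₆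
    where
    b₂ b₄ b₆ b₈ : R
    b₂ = a₁ ⊗ a₁ ⊕ ι 4 ⊗ a₂
    b₄ = ι 2 ⊗ a₄ ⊕ a₁ ⊗ a₃
    b₆ = a₃ ⊗ a₃ ⊕ ι 4 ⊗ a₆
    b₈ = a₁ ⊗ a₁ ⊗ a₆ ⊕ ι 4 ⊗ a₂ ⊗ a₆ ⊖ a₁ ⊗ a₃ ⊗ a₄ ⊕ a₂ ⊗ a₃ ⊗ a₃ ⊖ a₄ ⊗ a₄

  record Curve : Set where
    field
      a₁ a₂ a₃ a₄ a₆ : R
      Δ-unit : IsUnit (disc a₁ a₂ a₃ a₄ a₆)

  OnCurve : Curve → R → R → R → Set
  OnCurve E X Y Z =
    Y ⊗ Y ⊗ Z ⊕ a₁ ⊗ X ⊗ Y ⊗ Z ⊕ a₃ ⊗ Y ⊗ Z ⊗ Z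
      ≡ X ⊗ X ⊗ X ⊕ a₂ ⊗ X ⊗ X ⊗ Z ⊕ a₄ ⊗ X ⊗ Z ⊗ Z ⊕ a₆ ⊗ Z ⊗ Z ⊗ Z
    where open Curve E

  -- A point of E^∞ (kernel of reduction mod ε), given by its unique
  -- representative (P_x : 1 : P_z) with P_x, P_z ∈ (ε).
  record Einf (E : Curve) : Set where
    field
      Px Pz  : R
      Px∈ε   : ε ∣R Px
      Pz∈ε   : ε ∣R Pz
      onCurve : OnCurve E Px 1R Pz

  -- An addition law of bidegree (2,2) for the general Weierstrass
  -- equation (a Bosma–Lenstra type law; integral polynomial identity):
  -- for points P = (X₁:Y₁:Z₁), Q = (X₂:Y₂:Z₂) of E, whenever
  -- (lawX, lawY, lawZ) is unimodular it represents P + Q.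
  -- At (O,O) it takes the value (0:1:0), so on E^∞ × E^∞ the output has
  -- lawY ≡ 1 (mod ε), a unit; hence it computes the group law there.

  lawX : R → R → R → R → R → R → R → R → R → R → R → R
  lawX a₁ a₂ a₃ a₄ a₆ X₁ Y₁ Z₁ X₂ Y₂ Z₂ =
    0R
    ⊕ a₃ ⊗ a₄ ⊗ a₄ ⊗ Z₁ ⊗ Z₁ ⊗ Z₂ ⊗ Z₂
    ⊖ ι 4 ⊗ a₂ ⊗ a₃ ⊗ a₆ ⊗ Z₁ ⊗ Z₁ ⊗ Z₂ ⊗ Z₂
    ⊖ a₂ ⊗ a₃ ⊗ a₃ ⊗ a₃ ⊗ Z₁ ⊗ Z₁ ⊗ Z₂ ⊗ Z₂
    ⊕ a₁ ⊗ a₃ ⊗ a₃ ⊗ a₄ ⊗ Z₁ ⊗ Z₁ ⊗ Z₂ ⊗ Z₂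
    ⊖ a₁ ⊗ a₁ ⊗ a₃ ⊗ a₆ ⊗ Z₁ ⊗ Z₁ ⊗ Z₂ ⊗ Z₂
    ⊕ a₄ ⊗ a₄ ⊗ Z₁ ⊗ Z₁ ⊗ Y₂ ⊗ Z₂
    ⊖ ι 4 ⊗ a₂ ⊗ a₆ ⊗ Z₁ ⊗ Z₁ ⊗ Y₂ ⊗ Z₂
    ⊖ a₂ ⊗ a₃ ⊗ a₃ ⊗ Z₁ ⊗ Z₁ ⊗ Y₂ ⊗ Z₂
    ⊕ a₁ ⊗ a₃ ⊗ a₄ ⊗ Z₁ ⊗ Z₁ ⊗ Y₂ ⊗ Z₂
    ⊖ a₁ ⊗ a₁ ⊗ a₆ ⊗ Z₁ ⊗ Z₁ ⊗ Y₂ ⊗ Z₂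
    ⊖ ι 3 ⊗ a₃ ⊗ a₆ ⊗ Z₁ ⊗ Z₁ ⊗ X₂ ⊗ Z₂
    ⊖ a₃ ⊗ a₃ ⊗ a₃ ⊗ Z₁ ⊗ Z₁ ⊗ X₂ ⊗ Z₂
    ⊕ a₁ ⊗ a₄ ⊗ a₄ ⊗ Z₁ ⊗ Z₁ ⊗ X₂ ⊗ Z₂
    ⊖ ι 4 ⊗ a₁ ⊗ a₂ ⊗ a₆ ⊗ Z₁ ⊗ Z₁ ⊗ X₂ ⊗ Z₂
    ⊖ a₁ ⊗ a₂ ⊗ a₃ ⊗ a₃ ⊗ Z₁ ⊗ Z₁ ⊗ X₂ ⊗ Z₂
    ⊕ a₁ ⊗ a₁ ⊗ a₃ ⊗ a₄ ⊗ Z₁ ⊗ Z₁ ⊗ X₂ ⊗ Z₂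
    ⊖ a₁ ⊗ a₁ ⊗ a₁ ⊗ a₆ ⊗ Z₁ ⊗ Z₁ ⊗ X₂ ⊗ Z₂
    ⊖ ι 3 ⊗ a₆ ⊗ Z₁ ⊗ Z₁ ⊗ X₂ ⊗ Y₂
    ⊖ a₃ ⊗ a₃ ⊗ Z₁ ⊗ Z₁ ⊗ X₂ ⊗ Y₂
    ⊖ ι 3 ⊗ a₁ ⊗ a₆ ⊗ Z₁ ⊗ Z₁ ⊗ X₂ ⊗ X₂
    ⊖ a₁ ⊗ a₃ ⊗ a₃ ⊗ Z₁ ⊗ Z₁ ⊗ X₂ ⊗ X₂
    ⊕ a₄ ⊗ a₄ ⊗ Y₁ ⊗ Z₁ ⊗ Z₂ ⊗ Z₂
    ⊖ ι 4 ⊗ a₂ ⊗ a₆ ⊗ Y₁ ⊗ Z₁ ⊗ Z₂ ⊗ Z₂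
    ⊖ a₂ ⊗ a₃ ⊗ a₃ ⊗ Y₁ ⊗ Z₁ ⊗ Z₂ ⊗ Z₂
    ⊕ a₁ ⊗ a₃ ⊗ a₄ ⊗ Y₁ ⊗ Z₁ ⊗ Z₂ ⊗ Z₂
    ⊖ a₁ ⊗ a₁ ⊗ a₆ ⊗ Y₁ ⊗ Z₁ ⊗ Z₂ ⊗ Z₂
    ⊖ ι 6 ⊗ a₆ ⊗ Y₁ ⊗ Z₁ ⊗ X₂ ⊗ Z₂
    ⊖ ι 2 ⊗ a₃ ⊗ a₃ ⊗ Y₁ ⊗ Z₁ ⊗ X₂ ⊗ Z₂
    ⊖ a₄ ⊗ Y₁ ⊗ Z₁ ⊗ X₂ ⊗ X₂
    ⊖ a₁ ⊗ a₃ ⊗ Y₁ ⊗ Z₁ ⊗ X₂ ⊗ X₂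
    ⊕ Y₁ ⊗ Y₁ ⊗ X₂ ⊗ Y₂
    ⊖ ι 6 ⊗ a₃ ⊗ a₆ ⊗ X₁ ⊗ Z₁ ⊗ Z₂ ⊗ Z₂
    ⊖ a₃ ⊗ a₃ ⊗ a₃ ⊗ X₁ ⊗ Z₁ ⊗ Z₂ ⊗ Z₂
    ⊖ ι 6 ⊗ a₆ ⊗ X₁ ⊗ Z₁ ⊗ Y₂ ⊗ Z₂
    ⊕ a₃ ⊗ X₁ ⊗ Z₁ ⊗ Y₂ ⊗ Y₂
    ⊖ ι 2 ⊗ a₃ ⊗ a₄ ⊗ X₁ ⊗ Z₁ ⊗ X₂ ⊗ Z₂
    ⊖ ι 6 ⊗ a₁ ⊗ a₆ ⊗ X₁ ⊗ Z₁ ⊗ X₂ ⊗ Z₂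
    ⊖ ι 2 ⊗ a₁ ⊗ a₃ ⊗ a₃ ⊗ X₁ ⊗ Z₁ ⊗ X₂ ⊗ Z₂
    ⊖ ι 2 ⊗ a₄ ⊗ X₁ ⊗ Z₁ ⊗ X₂ ⊗ Y₂
    ⊖ ι 2 ⊗ a₁ ⊗ a₄ ⊗ X₁ ⊗ Z₁ ⊗ X₂ ⊗ X₂
    ⊖ a₁ ⊗ a₁ ⊗ a₃ ⊗ X₁ ⊗ Z₁ ⊗ X₂ ⊗ X₂
    ⊖ ι 3 ⊗ a₆ ⊗ X₁ ⊗ Y₁ ⊗ Z₂ ⊗ Z₂
    ⊕ ι 2 ⊗ a₃ ⊗ X₁ ⊗ Y₁ ⊗ Y₂ ⊗ Z₂
    ⊕ X₁ ⊗ Y₁ ⊗ Y₂ ⊗ Y₂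
    ⊖ ι 2 ⊗ a₄ ⊗ X₁ ⊗ Y₁ ⊗ X₂ ⊗ Z₂
    ⊕ ι 2 ⊗ a₁ ⊗ X₁ ⊗ Y₁ ⊗ X₂ ⊗ Y₂
    ⊖ a₂ ⊗ X₁ ⊗ Y₁ ⊗ X₂ ⊗ X₂
    ⊖ a₃ ⊗ a₄ ⊗ X₁ ⊗ X₁ ⊗ Z₂ ⊗ Z₂
    ⊖ a₄ ⊗ X₁ ⊗ X₁ ⊗ Y₂ ⊗ Z₂
    ⊕ a₁ ⊗ a₃ ⊗ X₁ ⊗ X₁ ⊗ Y₂ ⊗ Z₂
    ⊕ a₁ ⊗ X₁ ⊗ X₁ ⊗ Y₂ ⊗ Y₂
    ⊖ a₂ ⊗ a₃ ⊗ X₁ ⊗ X₁ ⊗ X₂ ⊗ Z₂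
    ⊖ a₁ ⊗ a₄ ⊗ X₁ ⊗ X₁ ⊗ X₂ ⊗ Z₂
    ⊖ a₂ ⊗ X₁ ⊗ X₁ ⊗ X₂ ⊗ Y₂
    ⊕ a₁ ⊗ a₁ ⊗ X₁ ⊗ X₁ ⊗ X₂ ⊗ Y₂
    ⊖ a₁ ⊗ a₂ ⊗ X₁ ⊗ X₁ ⊗ X₂ ⊗ X₂

  lawY : R → R → R → R → R → R → R → R → R → R → R → R
  lawY a₁ a₂ a₃ a₄ a₆ X₁ Y₁ Z₁ X₂ Y₂ Z₂ =
    0R
    ⊖ ι 9 ⊗ a₆ ⊗ a₆ ⊗ Z₁ ⊗ Z₁ ⊗ Z₂ ⊗ Z₂
    ⊖ a₄ ⊗ a₄ ⊗ a₄ ⊗ Z₁ ⊗ Z₁ ⊗ Z₂ ⊗ Z₂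
    ⊖ ι 6 ⊗ a₃ ⊗ a₃ ⊗ a₆ ⊗ Z₁ ⊗ Z₁ ⊗ Z₂ ⊗ Z₂
    ⊖ a₃ ⊗ a₃ ⊗ a₃ ⊗ a₃ ⊗ Z₁ ⊗ Z₁ ⊗ Z₂ ⊗ Z₂
    ⊕ ι 4 ⊗ a₂ ⊗ a₄ ⊗ a₆ ⊗ Z₁ ⊗ Z₁ ⊗ Z₂ ⊗ Z₂
    ⊕ a₂ ⊗ a₃ ⊗ a₃ ⊗ a₄ ⊗ Z₁ ⊗ Z₁ ⊗ Z₂ ⊗ Z₂
    ⊖ ι 2 ⊗ a₁ ⊗ a₃ ⊗ a₄ ⊗ a₄ ⊗ Z₁ ⊗ Z₁ ⊗ Z₂ ⊗ Z₂
    ⊕ ι 4 ⊗ a₁ ⊗ a₂ ⊗ a₃ ⊗ a₆ ⊗ Z₁ ⊗ Z₁ ⊗ Z₂ ⊗ Z₂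
    ⊕ a₁ ⊗ a₂ ⊗ a₃ ⊗ a₃ ⊗ a₃ ⊗ Z₁ ⊗ Z₁ ⊗ Z₂ ⊗ Z₂
    ⊕ a₁ ⊗ a₁ ⊗ a₄ ⊗ a₆ ⊗ Z₁ ⊗ Z₁ ⊗ Z₂ ⊗ Z₂
    ⊖ a₁ ⊗ a₁ ⊗ a₃ ⊗ a₃ ⊗ a₄ ⊗ Z₁ ⊗ Z₁ ⊗ Z₂ ⊗ Z₂
    ⊕ a₁ ⊗ a₁ ⊗ a₁ ⊗ a₃ ⊗ a₆ ⊗ Z₁ ⊗ Z₁ ⊗ Z₂ ⊗ Z₂
    ⊖ ι 3 ⊗ a₃ ⊗ a₆ ⊗ Z₁ ⊗ Z₁ ⊗ Y₂ ⊗ Z₂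
    ⊖ a₃ ⊗ a₃ ⊗ a₃ ⊗ Z₁ ⊗ Z₁ ⊗ Y₂ ⊗ Z₂
    ⊖ a₁ ⊗ a₄ ⊗ a₄ ⊗ Z₁ ⊗ Z₁ ⊗ Y₂ ⊗ Z₂
    ⊕ ι 4 ⊗ a₁ ⊗ a₂ ⊗ a₆ ⊗ Z₁ ⊗ Z₁ ⊗ Y₂ ⊗ Z₂
    ⊕ a₁ ⊗ a₂ ⊗ a₃ ⊗ a₃ ⊗ Z₁ ⊗ Z₁ ⊗ Y₂ ⊗ Z₂
    ⊖ a₁ ⊗ a₁ ⊗ a₃ ⊗ a₄ ⊗ Z₁ ⊗ Z₁ ⊗ Y₂ ⊗ Z₂
    ⊕ a₁ ⊗ a₁ ⊗ a₁ ⊗ a₆ ⊗ Z₁ ⊗ Z₁ ⊗ Y₂ ⊗ Z₂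
    ⊖ ι 3 ⊗ a₄ ⊗ a₆ ⊗ Z₁ ⊗ Z₁ ⊗ X₂ ⊗ Z₂
    ⊖ a₃ ⊗ a₃ ⊗ a₄ ⊗ Z₁ ⊗ Z₁ ⊗ X₂ ⊗ Z₂
    ⊖ a₂ ⊗ a₄ ⊗ a₄ ⊗ Z₁ ⊗ Z₁ ⊗ X₂ ⊗ Z₂
    ⊕ ι 4 ⊗ a₂ ⊗ a₂ ⊗ a₆ ⊗ Z₁ ⊗ Z₁ ⊗ X₂ ⊗ Z₂
    ⊕ a₂ ⊗ a₂ ⊗ a₃ ⊗ a₃ ⊗ Z₁ ⊗ Z₁ ⊗ X₂ ⊗ Z₂
    ⊖ ι 3 ⊗ a₁ ⊗ a₃ ⊗ a₆ ⊗ Z₁ ⊗ Z₁ ⊗ X₂ ⊗ Z₂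
    ⊖ a₁ ⊗ a₃ ⊗ a₃ ⊗ a₃ ⊗ Z₁ ⊗ Z₁ ⊗ X₂ ⊗ Z₂
    ⊖ a₁ ⊗ a₂ ⊗ a₃ ⊗ a₄ ⊗ Z₁ ⊗ Z₁ ⊗ X₂ ⊗ Z₂
    ⊖ a₁ ⊗ a₁ ⊗ a₄ ⊗ a₄ ⊗ Z₁ ⊗ Z₁ ⊗ X₂ ⊗ Z₂
    ⊕ ι 5 ⊗ a₁ ⊗ a₁ ⊗ a₂ ⊗ a₆ ⊗ Z₁ ⊗ Z₁ ⊗ X₂ ⊗ Z₂
    ⊕ a₁ ⊗ a₁ ⊗ a₂ ⊗ a₃ ⊗ a₃ ⊗ Z₁ ⊗ Z₁ ⊗ X₂ ⊗ Z₂
    ⊖ a₁ ⊗ a₁ ⊗ a₁ ⊗ a₃ ⊗ a₄ ⊗ Z₁ ⊗ Z₁ ⊗ X₂ ⊗ Z₂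
    ⊕ a₁ ⊗ a₁ ⊗ a₁ ⊗ a₁ ⊗ a₆ ⊗ Z₁ ⊗ Z₁ ⊗ X₂ ⊗ Z₂
    ⊖ a₃ ⊗ a₄ ⊗ Z₁ ⊗ Z₁ ⊗ X₂ ⊗ Y₂
    ⊕ ι 3 ⊗ a₁ ⊗ a₆ ⊗ Z₁ ⊗ Z₁ ⊗ X₂ ⊗ Y₂
    ⊖ a₄ ⊗ a₄ ⊗ Z₁ ⊗ Z₁ ⊗ X₂ ⊗ X₂
    ⊕ ι 3 ⊗ a₂ ⊗ a₆ ⊗ Z₁ ⊗ Z₁ ⊗ X₂ ⊗ X₂
    ⊕ a₂ ⊗ a₃ ⊗ a₃ ⊗ Z₁ ⊗ Z₁ ⊗ X₂ ⊗ X₂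
    ⊖ ι 2 ⊗ a₁ ⊗ a₃ ⊗ a₄ ⊗ Z₁ ⊗ Z₁ ⊗ X₂ ⊗ X₂
    ⊕ ι 3 ⊗ a₁ ⊗ a₁ ⊗ a₆ ⊗ Z₁ ⊗ Z₁ ⊗ X₂ ⊗ X₂
    ⊕ a₃ ⊗ Y₁ ⊗ Z₁ ⊗ Y₂ ⊗ Y₂
    ⊕ Y₁ ⊗ Y₁ ⊗ Y₂ ⊗ Y₂
    ⊖ ι 3 ⊗ a₄ ⊗ a₆ ⊗ X₁ ⊗ Z₁ ⊗ Z₂ ⊗ Z₂
    ⊖ ι 2 ⊗ a₃ ⊗ a₃ ⊗ a₄ ⊗ X₁ ⊗ Z₁ ⊗ Z₂ ⊗ Z₂
    ⊖ a₂ ⊗ a₄ ⊗ a₄ ⊗ X₁ ⊗ Z₁ ⊗ Z₂ ⊗ Z₂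
    ⊕ ι 4 ⊗ a₂ ⊗ a₂ ⊗ a₆ ⊗ X₁ ⊗ Z₁ ⊗ Z₂ ⊗ Z₂
    ⊕ a₂ ⊗ a₂ ⊗ a₃ ⊗ a₃ ⊗ X₁ ⊗ Z₁ ⊗ Z₂ ⊗ Z₂
    ⊕ ι 3 ⊗ a₁ ⊗ a₃ ⊗ a₆ ⊗ X₁ ⊗ Z₁ ⊗ Z₂ ⊗ Z₂
    ⊖ a₁ ⊗ a₂ ⊗ a₃ ⊗ a₄ ⊗ X₁ ⊗ Z₁ ⊗ Z₂ ⊗ Z₂
    ⊕ a₁ ⊗ a₁ ⊗ a₂ ⊗ a₆ ⊗ X₁ ⊗ Z₁ ⊗ Z₂ ⊗ Z₂
    ⊖ ι 2 ⊗ a₃ ⊗ a₄ ⊗ X₁ ⊗ Z₁ ⊗ Y₂ ⊗ Z₂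
    ⊕ ι 6 ⊗ a₁ ⊗ a₆ ⊗ X₁ ⊗ Z₁ ⊗ Y₂ ⊗ Z₂
    ⊖ ι 4 ⊗ a₄ ⊗ a₄ ⊗ X₁ ⊗ Z₁ ⊗ X₂ ⊗ Z₂
    ⊕ ι 12 ⊗ a₂ ⊗ a₆ ⊗ X₁ ⊗ Z₁ ⊗ X₂ ⊗ Z₂
    ⊕ ι 2 ⊗ a₂ ⊗ a₃ ⊗ a₃ ⊗ X₁ ⊗ Z₁ ⊗ X₂ ⊗ Z₂
    ⊖ ι 4 ⊗ a₁ ⊗ a₃ ⊗ a₄ ⊗ X₁ ⊗ Z₁ ⊗ X₂ ⊗ Z₂
    ⊕ ι 6 ⊗ a₁ ⊗ a₁ ⊗ a₆ ⊗ X₁ ⊗ Z₁ ⊗ X₂ ⊗ Z₂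
    ⊖ ι 2 ⊗ a₂ ⊗ a₃ ⊗ X₁ ⊗ Z₁ ⊗ X₂ ⊗ Y₂
    ⊕ ι 2 ⊗ a₁ ⊗ a₄ ⊗ X₁ ⊗ Z₁ ⊗ X₂ ⊗ Y₂
    ⊕ ι 9 ⊗ a₆ ⊗ X₁ ⊗ Z₁ ⊗ X₂ ⊗ X₂
    ⊕ ι 3 ⊗ a₃ ⊗ a₃ ⊗ X₁ ⊗ Z₁ ⊗ X₂ ⊗ X₂
    ⊖ a₂ ⊗ a₄ ⊗ X₁ ⊗ Z₁ ⊗ X₂ ⊗ X₂
    ⊖ ι 2 ⊗ a₁ ⊗ a₂ ⊗ a₃ ⊗ X₁ ⊗ Z₁ ⊗ X₂ ⊗ X₂
    ⊕ a₁ ⊗ a₁ ⊗ a₄ ⊗ X₁ ⊗ Z₁ ⊗ X₂ ⊗ X₂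
    ⊕ a₁ ⊗ X₁ ⊗ Y₁ ⊗ Y₂ ⊗ Y₂
    ⊖ a₄ ⊗ a₄ ⊗ X₁ ⊗ X₁ ⊗ Z₂ ⊗ Z₂
    ⊕ ι 3 ⊗ a₂ ⊗ a₆ ⊗ X₁ ⊗ X₁ ⊗ Z₂ ⊗ Z₂
    ⊖ a₂ ⊗ a₃ ⊗ X₁ ⊗ X₁ ⊗ Y₂ ⊗ Z₂
    ⊕ a₁ ⊗ a₄ ⊗ X₁ ⊗ X₁ ⊗ Y₂ ⊗ Z₂
    ⊕ ι 9 ⊗ a₆ ⊗ X₁ ⊗ X₁ ⊗ X₂ ⊗ Z₂
    ⊖ a₂ ⊗ a₄ ⊗ X₁ ⊗ X₁ ⊗ X₂ ⊗ Z₂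
    ⊖ ι 3 ⊗ a₃ ⊗ X₁ ⊗ X₁ ⊗ X₂ ⊗ Y₂
    ⊕ a₁ ⊗ a₂ ⊗ X₁ ⊗ X₁ ⊗ X₂ ⊗ Y₂
    ⊕ ι 3 ⊗ a₄ ⊗ X₁ ⊗ X₁ ⊗ X₂ ⊗ X₂
    ⊖ a₂ ⊗ a₂ ⊗ X₁ ⊗ X₁ ⊗ X₂ ⊗ X₂

  lawZ : R → R → R → R → R → R → R → R → R → R → R → R
  lawZ a₁ a₂ a₃ a₄ a₆ X₁ Y₁ Z₁ X₂ Y₂ Z₂ =
    0R
    ⊕ ι 3 ⊗ a₃ ⊗ a₆ ⊗ Z₁ ⊗ Z₁ ⊗ Z₂ ⊗ Z₂
    ⊕ a₃ ⊗ a₃ ⊗ a₃ ⊗ Z₁ ⊗ Z₁ ⊗ Z₂ ⊗ Z₂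
    ⊕ ι 3 ⊗ a₆ ⊗ Z₁ ⊗ Z₁ ⊗ Y₂ ⊗ Z₂
    ⊕ ι 2 ⊗ a₃ ⊗ a₃ ⊗ Z₁ ⊗ Z₁ ⊗ Y₂ ⊗ Z₂
    ⊕ a₃ ⊗ Z₁ ⊗ Z₁ ⊗ Y₂ ⊗ Y₂
    ⊕ a₃ ⊗ a₄ ⊗ Z₁ ⊗ Z₁ ⊗ X₂ ⊗ Z₂
    ⊕ ι 3 ⊗ a₁ ⊗ a₆ ⊗ Z₁ ⊗ Z₁ ⊗ X₂ ⊗ Z₂
    ⊕ ι 2 ⊗ a₁ ⊗ a₃ ⊗ a₃ ⊗ Z₁ ⊗ Z₁ ⊗ X₂ ⊗ Z₂
    ⊕ a₄ ⊗ Z₁ ⊗ Z₁ ⊗ X₂ ⊗ Y₂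
    ⊕ ι 2 ⊗ a₁ ⊗ a₃ ⊗ Z₁ ⊗ Z₁ ⊗ X₂ ⊗ Y₂
    ⊕ a₁ ⊗ a₄ ⊗ Z₁ ⊗ Z₁ ⊗ X₂ ⊗ X₂
    ⊕ a₁ ⊗ a₁ ⊗ a₃ ⊗ Z₁ ⊗ Z₁ ⊗ X₂ ⊗ X₂
    ⊕ ι 3 ⊗ a₆ ⊗ Y₁ ⊗ Z₁ ⊗ Z₂ ⊗ Z₂
    ⊕ a₃ ⊗ a₃ ⊗ Y₁ ⊗ Z₁ ⊗ Z₂ ⊗ Z₂
    ⊕ ι 2 ⊗ a₃ ⊗ Y₁ ⊗ Z₁ ⊗ Y₂ ⊗ Z₂
    ⊕ Y₁ ⊗ Z₁ ⊗ Y₂ ⊗ Y₂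
    ⊕ ι 2 ⊗ a₄ ⊗ Y₁ ⊗ Z₁ ⊗ X₂ ⊗ Z₂
    ⊕ ι 2 ⊗ a₁ ⊗ a₃ ⊗ Y₁ ⊗ Z₁ ⊗ X₂ ⊗ Z₂
    ⊕ ι 2 ⊗ a₁ ⊗ Y₁ ⊗ Z₁ ⊗ X₂ ⊗ Y₂
    ⊕ a₂ ⊗ Y₁ ⊗ Z₁ ⊗ X₂ ⊗ X₂
    ⊕ a₁ ⊗ a₁ ⊗ Y₁ ⊗ Z₁ ⊗ X₂ ⊗ X₂
    ⊕ Y₁ ⊗ Y₁ ⊗ Y₂ ⊗ Z₂
    ⊕ ι 2 ⊗ a₃ ⊗ a₄ ⊗ X₁ ⊗ Z₁ ⊗ Z₂ ⊗ Z₂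
    ⊕ a₁ ⊗ a₃ ⊗ a₃ ⊗ X₁ ⊗ Z₁ ⊗ Z₂ ⊗ Z₂
    ⊕ ι 2 ⊗ a₄ ⊗ X₁ ⊗ Z₁ ⊗ Y₂ ⊗ Z₂
    ⊕ ι 2 ⊗ a₁ ⊗ a₃ ⊗ X₁ ⊗ Z₁ ⊗ Y₂ ⊗ Z₂
    ⊕ a₁ ⊗ X₁ ⊗ Z₁ ⊗ Y₂ ⊗ Y₂
    ⊕ ι 2 ⊗ a₂ ⊗ a₃ ⊗ X₁ ⊗ Z₁ ⊗ X₂ ⊗ Z₂
    ⊕ ι 2 ⊗ a₁ ⊗ a₄ ⊗ X₁ ⊗ Z₁ ⊗ X₂ ⊗ Z₂
    ⊕ ι 2 ⊗ a₁ ⊗ a₁ ⊗ a₃ ⊗ X₁ ⊗ Z₁ ⊗ X₂ ⊗ Z₂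
    ⊕ ι 2 ⊗ a₂ ⊗ X₁ ⊗ Z₁ ⊗ X₂ ⊗ Y₂
    ⊕ ι 2 ⊗ a₁ ⊗ a₁ ⊗ X₁ ⊗ Z₁ ⊗ X₂ ⊗ Y₂
    ⊕ ι 2 ⊗ a₁ ⊗ a₂ ⊗ X₁ ⊗ Z₁ ⊗ X₂ ⊗ X₂
    ⊕ a₁ ⊗ a₁ ⊗ a₁ ⊗ X₁ ⊗ Z₁ ⊗ X₂ ⊗ X₂
    ⊕ a₄ ⊗ X₁ ⊗ Y₁ ⊗ Z₂ ⊗ Z₂
    ⊕ ι 2 ⊗ a₂ ⊗ X₁ ⊗ Y₁ ⊗ X₂ ⊗ Z₂
    ⊕ ι 3 ⊗ X₁ ⊗ Y₁ ⊗ X₂ ⊗ X₂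
    ⊕ a₂ ⊗ a₃ ⊗ X₁ ⊗ X₁ ⊗ Z₂ ⊗ Z₂
    ⊕ a₂ ⊗ X₁ ⊗ X₁ ⊗ Y₂ ⊗ Z₂
    ⊕ ι 3 ⊗ a₃ ⊗ X₁ ⊗ X₁ ⊗ X₂ ⊗ Z₂
    ⊕ a₁ ⊗ a₂ ⊗ X₁ ⊗ X₁ ⊗ X₂ ⊗ Z₂
    ⊕ ι 3 ⊗ X₁ ⊗ X₁ ⊗ X₂ ⊗ Y₂
    ⊕ ι 3 ⊗ a₁ ⊗ X₁ ⊗ X₁ ⊗ X₂ ⊗ X₂

  sumTriple : (E : Curve) → Einf E → Einf E → R × R × R
  sumTriple E P Q =
      lawX a₁ a₂ a₃ a₄ a₆ (Px P) 1R (Pz P) (Px Q) 1R (Pz Q)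
    , lawY a₁ a₂ a₃ a₄ a₆ (Px P) 1R (Pz P) (Px Q) 1R (Pz Q)
    , lawZ a₁ a₂ a₃ a₄ a₆ (Px P) 1R (Pz P) (Px Q) 1R (Pz Q)
    where open Curve E
          open Einf

  sumX : (E : Curve) → Einf E → Einf E → R
  sumX E P Q with sumTriple E P Q
  ... | X₃ , Y₃ , Z₃ = X₃ ⊗ invR Y₃

{-# OPTIONS --safe #-}
module Submission where

-- For P ∈ E^∞ the curve equation
-- z (1 + a₁x + a₃z) = x³ + a₂x²z + a₄xz² + a₆z³ (with x = P_x, z = P_z) forces ε^(m+1) ∣ P_z
-- as soon as ε^m ∣ P_x.  Evaluate the addition law at (P_x : 1 : P_z) and (Q_x : 1 : Q_z):
-- apart from Y₁²X₂Y₂ and X₁Y₁Y₂², every monomial of lawX contains a Z or two X's, so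
-- lawX ≡ P_x + Q_x (mod ε^(m+1)); apart from Y₁²Y₂², every monomial of lawY contains an X or a
-- Z, so lawY ≡ 1 (mod ε).  Since ε^m ∣ P_x + Q_x, multiplying by lawY⁻¹ ≡ 1 (mod ε) does not
-- change the class mod ε^(m+1), so (P + Q)_x ≡ P_x + Q_x, and the theorem follows by adding
-- the congruences for P_x and Q_x.

open import Defs
open import Level using (0ℓ)
open import Algebra.Bundles using (CommutativeRing)
open import Algebra.Structures using (IsCommutativeRing)
open import Data.Nat as ℕ using (ℕ; zero; suc; _≤_)
import Data.Nat.Properties as ℕₚ
open import Data.Product using (_,_)
open import Data.Vec using (Vec; []; _∷_; _∷ʳ_; zipWith; map; replicate)
open import Data.Vec.Properties
  using (zipWith-identityˡ; zipWith-identityʳ; map-replicate; map-cong; map-id)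
open import Function using (_∘_)
open import Relation.Binary.Bundles using (Setoid)
import Relation.Binary.Reasoning.Setoid as SetoidReasoning
open import Relation.Binary.PropositionalEquality
  using (_≡_; refl; sym; trans; cong; cong₂; subst; module ≡-Reasoning)

module TruncPolyProperties (𝔽 : FiniteField) (k : ℕ) where
  open FiniteField 𝔽
  open TruncPoly 𝔽 k
  open IsCommutativeRing isCommutativeRing
    using ( +-identityˡ; +-identityʳ; +-comm; -‿inverseʳ
          ; zeroˡ; zeroʳ; *-identityˡ; *-identityʳ; distribʳ)

  commutativeRing : CommutativeRing 0ℓ 0ℓ
  commutativeRing = record { isCommutativeRing = isCommutativeRing }

  open import Algebra.Properties.Ring (CommutativeRing.ring commutativeRing)
    using (-0#≈0#; x∙y⁻¹≈ε⇒x≈y)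

  private variable
    i j n : ℕ
    x y : Carrier
    u u′ v v′ w : Vec Carrier n

  -- Congruence modulo ε^j

  infix 4 _≈[_]_ _∈ε^_

  -- u ≈[ j ] v is u ≡ v (mod ε^j): the first j coefficients agree (vectors shorter than j must
  -- be equal).  u ∈ε^ j is ε^j ∣ u.
  data _≈[_]_ : Vec Carrier n → ℕ → Vec Carrier n → Set where
    ≈-zero : u ≈[ 0 ] v
    []     : [] ≈[ suc j ] []
    _∷_    : x ≡ y → u ≈[ j ] v → x ∷ u ≈[ suc j ] y ∷ v

  0s : Vec Carrier n
  0s = replicate _ 0#

  _∈ε^_ : Vec Carrier n → ℕ → Set
  u ∈ε^ j = u ≈[ j ] 0s

  ≈-refl : u ≈[ j ] u
  ≈-refl {j = zero}            = ≈-zero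
  ≈-refl {u = []}    {suc j}   = []
  ≈-refl {u = x ∷ u} {suc j}   = refl ∷ ≈-refl

  ≈-sym : u ≈[ j ] v → v ≈[ j ] u
  ≈-sym ≈-zero  = ≈-zero
  ≈-sym []      = []
  ≈-sym (e ∷ h) = sym e ∷ ≈-sym h

  ≈-trans : u ≈[ j ] v → v ≈[ j ] w → u ≈[ j ] w
  ≈-trans ≈-zero  _         = ≈-zero
  ≈-trans []      []        = []
  ≈-trans (e ∷ h) (e′ ∷ h′) = trans e e′ ∷ ≈-trans h h′

  ≈-setoid : ℕ → Setoid 0ℓ 0ℓ
  ≈-setoid j = record
    { Carrier       = R
    ; _≈_           = _≈[ j ]_
    ; isEquivalence = record { refl = ≈-refl ; sym = ≈-sym ; trans = ≈-trans }
    }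

  ≡⇒≈ : u ≡ v → u ≈[ j ] v
  ≡⇒≈ refl = ≈-refl

  ≈-cast : i ≡ j → u ≈[ i ] v → u ≈[ j ] v
  ≈-cast refl u≈v = u≈v

  ≈-pred : u ≈[ suc j ] v → u ≈[ j ] v
  ≈-pred {j = zero}  _       = ≈-zero
  ≈-pred {j = suc j} []      = []
  ≈-pred {j = suc j} (e ∷ h) = e ∷ ≈-pred h

  ≈-dropLast : u ≈[ j ] v → dropLast u ≈[ j ] dropLast v
  ≈-dropLast ≈-zero                                  = ≈-zero
  ≈-dropLast {u = _ ∷ []}    {v = _ ∷ []}    (e ∷ h) = ≈-refl
  ≈-dropLast {u = _ ∷ _ ∷ _} {v = _ ∷ _ ∷ _} (e ∷ h) = e ∷ ≈-dropLast h

  ⊕-cong : u ≈[ j ] u′ → v ≈[ j ] v′ → zipWith _+_ u v ≈[ j ] zipWith _+_ u′ v′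
  ⊕-cong ≈-zero  _         = ≈-zero
  ⊕-cong []      []        = []
  ⊕-cong (e ∷ h) (e′ ∷ h′) = cong₂ _+_ e e′ ∷ ⊕-cong h h′

  ⊝-cong : u ≈[ j ] u′ → map -_ u ≈[ j ] map -_ u′
  ⊝-cong ≈-zero  = ≈-zero
  ⊝-cong []      = []
  ⊝-cong (e ∷ h) = cong -_ e ∷ ⊝-cong h

  scale-cong : x ≡ y → u ≈[ j ] u′ → map (x *_) u ≈[ j ] map (y *_) u′
  scale-cong _   ≈-zero  = ≈-zero
  scale-cong _   []      = []
  scale-cong x≡y (e ∷ h) = cong₂ _*_ x≡y e ∷ scale-cong x≡y h

  ∈ε^-resp-≈ : u ≈[ j ] v → u ∈ε^ j → v ∈ε^ j
  ∈ε^-resp-≈ u≈v u∈ = ≈-trans (≈-sym u≈v) u∈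

  ⊕-∈ε^ : u ∈ε^ j → v ∈ε^ j → zipWith _+_ u v ∈ε^ j
  ⊕-∈ε^ u∈ v∈ = ≈-trans (⊕-cong u∈ v∈) (≡⇒≈ (zipWith-identityˡ +-identityˡ 0s))

  ⊝-∈ε^ : u ∈ε^ j → map -_ u ∈ε^ j
  ⊝-∈ε^ u∈ = ≈-trans (⊝-cong u∈) (≡⇒≈ (trans (map-replicate -_ 0# _) (cong (replicate _) -0#≈0#)))

  ⊕-cancelʳ-∈ε^ : zipWith _+_ u v ∈ε^ j → v ∈ε^ j → u ∈ε^ j
  ⊕-cancelʳ-∈ε^ {u = u} u+v∈ v∈ =
    ≈-trans (≡⇒≈ (sym (zipWith-identityʳ +-identityʳ u))) (≈-trans (⊕-cong ≈-refl (≈-sym v∈)) u+v∈)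

  infixl 6 _⊕⁰_ _⊖⁰_ _⊕⁼_

  _⊕⁰_ : u ≈[ j ] w → v ∈ε^ j → zipWith _+_ u v ≈[ j ] w
  _⊕⁰_ {w = w} u≈w v∈ = ≈-trans (⊕-cong u≈w v∈) (≡⇒≈ (zipWith-identityʳ +-identityʳ w))

  _⊖⁰_ : u ≈[ j ] w → v ∈ε^ j → zipWith _+_ u (map -_ v) ≈[ j ] w
  u≈w ⊖⁰ v∈ = u≈w ⊕⁰ ⊝-∈ε^ v∈

  _⊕⁼_ : u ≈[ j ] w → (v : Vec Carrier n) → zipWith _+_ u v ≈[ j ] zipWith _+_ w v
  u≈w ⊕⁼ v = ⊕-cong u≈w ≈-refl

  ≈⇒⊖∈ε^ : u ≈[ j ] v → zipWith _+_ u (map -_ v) ∈ε^ j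
  ≈⇒⊖∈ε^ ≈-zero              = ≈-zero
  ≈⇒⊖∈ε^ []                  = []
  ≈⇒⊖∈ε^ {u = x ∷ _} (e ∷ h) = trans (cong (λ y → x + - y) (sym e)) (-‿inverseʳ x) ∷ ≈⇒⊖∈ε^ h

  ⊖∈ε^⇒≈ : zipWith _+_ u (map -_ v) ∈ε^ j → u ≈[ j ] v
  ⊖∈ε^⇒≈ {j = zero}                        _       = ≈-zero
  ⊖∈ε^⇒≈ {u = []}    {v = []}    {suc j} _       = []
  ⊖∈ε^⇒≈ {u = x ∷ _} {v = y ∷ _} {suc j} (e ∷ h) = x∙y⁻¹≈ε⇒x≈y x y e ∷ ⊖∈ε^⇒≈ h

  -- Truncated multiplication

  scale-zero : x ≡ 0# → map (x *_) u ≡ 0s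
  scale-zero {u = []}    _   = refl
  scale-zero {u = b ∷ u} x≡0 = cong₂ _∷_ (trans (cong (_* b) x≡0) (zeroˡ b)) (scale-zero x≡0)

  scale-0s : map (x *_) 0s ≡ 0s {n}
  scale-0s {x = x} = trans (map-replicate (x *_) 0# _) (cong (replicate _) (zeroʳ x))

  dropLast-0s : dropLast (0s {suc n}) ≡ 0s
  dropLast-0s {zero}  = refl
  dropLast-0s {suc n} = cong (0# ∷_) dropLast-0s

  0∷-⊗ : (u : Vec Carrier n) (v : Vec Carrier (suc n)) →
         mulV (0# ∷ u) v ≡ 0# ∷ mulV u (dropLast v)
  0∷-⊗ u v@(_ ∷ _) = begin
    zipWith _+_ (map (0# *_) v) (0# ∷ mulV u (dropLast v))
      ≡⟨ cong (λ s → zipWith _+_ s (0# ∷ mulV u (dropLast v))) (scale-zero refl) ⟩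
    zipWith _+_ 0s (0# ∷ mulV u (dropLast v))
      ≡⟨ zipWith-identityˡ +-identityˡ _ ⟩
    0# ∷ mulV u (dropLast v) ∎
    where open ≡-Reasoning

  ⊗-zeroˡ : (v : Vec Carrier n) → mulV 0s v ≡ 0s
  ⊗-zeroˡ []        = refl
  ⊗-zeroˡ v@(_ ∷ _) = trans (0∷-⊗ 0s v) (cong (0# ∷_) (⊗-zeroˡ (dropLast v)))

  ⊗-zeroʳ : (u : Vec Carrier n) → mulV u 0s ≡ 0s
  ⊗-zeroʳ []      = refl
  ⊗-zeroʳ (a ∷ u) = begin
    zipWith _+_ (map (a *_) 0s) (0# ∷ mulV u (dropLast 0s))
      ≡⟨ cong₂ (zipWith _+_) scale-0s (cong (λ s → 0# ∷ mulV u s) dropLast-0s) ⟩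
    zipWith _+_ 0s (0# ∷ mulV u 0s)
      ≡⟨ zipWith-identityˡ +-identityˡ _ ⟩
    0# ∷ mulV u 0s
      ≡⟨ cong (0# ∷_) (⊗-zeroʳ u) ⟩
    0s ∎
    where open ≡-Reasoning

  const-⊗ : ∀ c (v : Vec Carrier n) → mulV (constV c) v ≡ map (c *_) v
  const-⊗ c []        = refl
  const-⊗ c v@(_ ∷ _) = begin
    zipWith _+_ (map (c *_) v) (0# ∷ mulV 0s (dropLast v))
      ≡⟨ cong (λ s → zipWith _+_ (map (c *_) v) (0# ∷ s)) (⊗-zeroˡ (dropLast v)) ⟩
    zipWith _+_ (map (c *_) v) 0s
      ≡⟨ zipWith-identityʳ +-identityʳ _ ⟩
    map (c *_) v ∎
    where open ≡-Reasoning

  ⊗-identityˡ : (v : Vec Carrier n) → mulV (constV 1#) v ≡ v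
  ⊗-identityˡ v = trans (const-⊗ 1# v) (trans (map-cong *-identityˡ v) (map-id v))

  dropLast-1 : dropLast (constV {suc n} 1#) ≡ constV 1#
  dropLast-1 {zero}  = refl
  dropLast-1 {suc n} = cong (1# ∷_) dropLast-0s

  ⊗-identityʳ : (u : Vec Carrier n) → mulV u (constV 1#) ≡ u
  ⊗-identityʳ []      = refl
  ⊗-identityʳ (a ∷ u) = cong₂ _∷_ (trans (+-identityʳ _) (*-identityʳ a)) (begin
    zipWith _+_ (map (a *_) 0s) (mulV u (dropLast (constV 1#)))
      ≡⟨ cong₂ (zipWith _+_) scale-0s (cong (mulV u) dropLast-1) ⟩
    zipWith _+_ 0s (mulV u (constV 1#))
      ≡⟨ zipWith-identityˡ +-identityˡ _ ⟩
    mulV u (constV 1#)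
      ≡⟨ ⊗-identityʳ u ⟩
    u ∎)
    where open ≡-Reasoning

  ⊗-cong : u ≈[ j ] u′ → v ≈[ j ] v′ → mulV u v ≈[ j ] mulV u′ v′
  ⊗-cong ≈-zero  _                = ≈-zero
  ⊗-cong []      []               = []
  ⊗-cong (e ∷ h) v≈v′@(_ ∷ _) =
    ⊕-cong (scale-cong e v≈v′) (refl ∷ ⊗-cong h (≈-dropLast (≈-pred v≈v′)))

  ⊗-congʳ-∈ε^ : u ∈ε^ i → v ≈[ j ] v′ → mulV u v ≈[ i ℕ.+ j ] mulV u v′
  ⊗-congʳ-∈ε^ {u = u} ≈-zero v≈v′ = ⊗-cong (≈-refl {u = u}) v≈v′
  ⊗-congʳ-∈ε^ {v = []} {v′ = []} [] _ = []
  ⊗-congʳ-∈ε^ {v = _ ∷ _} {v′ = _ ∷ _} (a≡0 ∷ u∈) v≈v′ =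
    ⊕-cong (≡⇒≈ (trans (scale-zero a≡0) (sym (scale-zero a≡0))))
           (refl ∷ ⊗-congʳ-∈ε^ u∈ (≈-dropLast v≈v′))

  ∈ε^-⊗ : u ∈ε^ i → v ∈ε^ j → mulV u v ∈ε^ (i ℕ.+ j)
  ∈ε^-⊗ {u = u} u∈ v∈ = ≈-trans (⊗-congʳ-∈ε^ u∈ v∈) (≡⇒≈ (⊗-zeroʳ u))

  -- A product lies in (ε^j) if a factor marked by its proof does: a ⊗· p and p ·⊗ a mark the
  -- right resp. left factor, and p ·⊗· q marks a factor in (ε^j) times one in (ε).
  infixl 7 _⊗·_ _·⊗_ _·⊗·_

  _⊗·_ : (u : Vec Carrier n) → v ∈ε^ j → mulV u v ∈ε^ j
  u ⊗· v∈ = ∈ε^-⊗ {u = u} ≈-zero v∈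

  _·⊗_ : u ∈ε^ j → (v : Vec Carrier n) → mulV u v ∈ε^ j
  u∈ ·⊗ v = ≈-trans (⊗-cong u∈ ≈-refl) (≡⇒≈ (⊗-zeroˡ v))

  _·⊗·_ : u ∈ε^ j → v ∈ε^ 1 → mulV u v ∈ε^ suc j
  _·⊗·_ {j = j} u∈ v∈ = ≈-cast (ℕₚ.+-comm j 1) (∈ε^-⊗ u∈ v∈)

  -- Powers of ε

  εpow : ℕ → ∀ {n} → Vec Carrier n
  εpow zero            = constV 1#
  εpow (suc j) {zero}  = []
  εpow (suc j) {suc n} = 0# ∷ εpow j

  shift : ℕ → ∀ {n} → Vec Carrier n → Vec Carrier n
  shift zero            v = v
  shift (suc j) {zero}  _ = []
  shift (suc j) {suc n} v = 0# ∷ shift j (dropLast v)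

  unshift : ℕ → Vec Carrier n → Vec Carrier n
  unshift zero    v       = v
  unshift (suc j) []      = []
  unshift (suc j) (x ∷ v) = unshift j v ∷ʳ 0#

  εpow-⊗ : ∀ j (v : Vec Carrier n) → mulV (εpow j) v ≡ shift j v
  εpow-⊗ zero    v         = ⊗-identityˡ v
  εpow-⊗ (suc j) []        = refl
  εpow-⊗ (suc j) v@(_ ∷ _) = trans (0∷-⊗ (εpow j) v) (cong (0# ∷_) (εpow-⊗ j (dropLast v)))

  dropLast-εpow : ∀ j → dropLast (εpow j {suc n}) ≡ εpow j
  dropLast-εpow         zero          = dropLast-1
  dropLast-εpow {zero}  (suc zero)    = refl
  dropLast-εpow {zero}  (suc (suc j)) = refl
  dropLast-εpow {suc n} (suc zero)    = cong (0# ∷_) (dropLast-εpow zero)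
  dropLast-εpow {suc n} (suc (suc j)) = cong (0# ∷_) (dropLast-εpow (suc j))

  epsV≡εpow1 : epsV ≡ εpow 1 {n}
  epsV≡εpow1 {zero}        = refl
  epsV≡εpow1 {suc zero}    = refl
  epsV≡εpow1 {suc (suc n)} = refl

  ε^≡εpow : ∀ j → ε^ j ≡ εpow j
  ε^≡εpow zero    = refl
  ε^≡εpow (suc j) = begin
    mulV epsV (ε^ j)       ≡⟨ cong₂ mulV epsV≡εpow1 (ε^≡εpow j) ⟩
    mulV (εpow 1) (εpow j) ≡⟨ εpow-⊗ 1 (εpow j) ⟩
    shift 1 (εpow j)       ≡⟨ shift-εpow k ⟩
    εpow (suc j)           ∎
    where
    open ≡-Reasoning
    shift-εpow : ∀ n → shift 1 (εpow j {n}) ≡ εpow (suc j)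
    shift-εpow zero    = refl
    shift-εpow (suc n) = cong (0# ∷_) (dropLast-εpow j)

  ε^-⊗ : ∀ j c → ε^ j ⊗ c ≡ shift j c
  ε^-⊗ j c = trans (cong (λ e → mulV e c) (ε^≡εpow j)) (εpow-⊗ j c)

  shift-∈ε^ : ∀ j {n} (v : Vec Carrier n) → shift j v ∈ε^ j
  shift-∈ε^ zero            v = ≈-zero
  shift-∈ε^ (suc j) {zero}  v = []
  shift-∈ε^ (suc j) {suc n} v = refl ∷ shift-∈ε^ j (dropLast v)

  dropLast-∷ʳ : (v : Vec Carrier n) → dropLast (v ∷ʳ x) ≡ v
  dropLast-∷ʳ []          = refl
  dropLast-∷ʳ (y ∷ [])    = refl
  dropLast-∷ʳ (y ∷ z ∷ v) = cong (y ∷_) (dropLast-∷ʳ (z ∷ v))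

  shift-unshift : v ∈ε^ j → shift j (unshift j v) ≡ v
  shift-unshift ≈-zero                         = refl
  shift-unshift []                             = refl
  shift-unshift {v = x ∷ v} {suc j} (x≡0 ∷ v∈) =
    cong₂ _∷_ (sym x≡0) (trans (cong (shift j) (dropLast-∷ʳ (unshift j v))) (shift-unshift v∈))

  ∣R⇒∈ε^ : ∀ {j r} → (ε^ j) ∣R r → r ∈ε^ j
  ∣R⇒∈ε^ {j} (c , r≡) = subst (_∈ε^ j) (sym (trans r≡ (ε^-⊗ j c))) (shift-∈ε^ j c)

  ∈ε^⇒∣R : ∀ {j r} → r ∈ε^ j → (ε^ j) ∣R r
  ∈ε^⇒∣R {j} {r} r∈ = unshift j r , sym (trans (ε^-⊗ j (unshift j r)) (shift-unshift r∈))

  mod⇒≈ : ∀ {j a b} → a ≡ b [mod-ε^ j ] → a ≈[ j ] b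
  mod⇒≈ = ⊖∈ε^⇒≈ ∘ ∣R⇒∈ε^

  ≈⇒mod : ∀ {j a b} → a ≈[ j ] b → a ≡ b [mod-ε^ j ]
  ≈⇒mod = ∈ε^⇒∣R ∘ ≈⇒⊖∈ε^

  ε^-∈ε^ : ∀ j → ε^ j ∈ε^ j
  ε^-∈ε^ j = ∣R⇒∈ε^ (1R , sym (⊗-identityʳ (ε^ j)))

  ε∣R⇒∈ε^1 : ∀ {r} → ε ∣R r → r ∈ε^ 1
  ε∣R⇒∈ε^1 (c , r≡εc) = ∣R⇒∈ε^ (c , trans r≡εc (cong (_⊗ c) (sym (⊗-identityʳ ε))))

  ≈const⊗ε^⇒∈ε^ : ∀ {m c r} → r ≈[ suc m ] const c ⊗ ε^ m → r ∈ε^ m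
  ≈const⊗ε^⇒∈ε^ {m} {c} r≈ = ∈ε^-resp-≈ (≈-sym (≈-pred r≈)) (const c ⊗· ε^-∈ε^ m)

  const-+-⊗ : ∀ c d (v : R) → const d ⊗ v ⊕ const c ⊗ v ≡ const (c + d) ⊗ v
  const-+-⊗ c d v = begin
    zipWith _+_ (mulV (constV d) v) (mulV (constV c) v) ≡⟨ cong₂ (zipWith _+_) (const-⊗ d v) (const-⊗ c v) ⟩
    zipWith _+_ (map (d *_) v) (map (c *_) v)           ≡⟨ scale-+ v ⟩
    map ((c + d) *_) v                                  ≡⟨ const-⊗ (c + d) v ⟨
    mulV (constV (c + d)) v                             ∎
    where
    open ≡-Reasoning
    scale-+ : ∀ {n} (v : Vec Carrier n) → zipWith _+_ (map (d *_) v) (map (c *_) v) ≡ map ((c + d) *_) v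
    scale-+ []      = refl
    scale-+ (b ∷ v) = cong₂ _∷_ (trans (+-comm (d * b) (c * b)) (sym (distribʳ b c d))) (scale-+ v)

  1#⁻¹≡1# : 1# ⁻¹ ≡ 1#
  1#⁻¹≡1# = trans (sym (*-identityˡ (1# ⁻¹))) (⁻¹-inverse 1# (0≢1 ∘ sym))

  geom-≈1 : ∀ {r} j → r ∈ε^ 1 → geom r (suc j) ≈[ 1 ] 1R
  geom-≈1 {r} j r∈ = ≈-refl {u = 1R} ⊕⁰ r∈ ·⊗ geom r j

  invR-≈1 : (u : R) → u ≈[ 1 ] 1R → invR u ≈[ 1 ] 1R
  invR-≈1 []                _             = []
  invR-≈1 u@(_∷_ {k′} x _)  u≈1@(x≡1 ∷ _) =
    ≈-trans (⊗-cong x⁻¹≈1 (geom-≈1 k′ 1-x⁻¹u∈)) (≡⇒≈ (⊗-identityˡ 1R))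
    where
    x⁻¹≈1 : const (x ⁻¹) ≈[ 1 ] 1R
    x⁻¹≈1 = trans (cong _⁻¹ x≡1) 1#⁻¹≡1# ∷ ≈-zero
    1-x⁻¹u∈ : 1R ⊖ const (x ⁻¹) ⊗ u ∈ε^ 1
    1-x⁻¹u∈ = ≈⇒⊖∈ε^ (≈-sym (≈-trans (⊗-cong x⁻¹≈1 u≈1) (≡⇒≈ (⊗-identityˡ 1R))))

  -- The addition law on E^∞

  ⊕-identityˡ : (t : R) → 0R ⊕ t ≡ t
  ⊕-identityˡ t = trans (cong (_⊕ t) 0R≡0s) (zipWith-identityˡ +-identityˡ t)
    where
    0R≡0s : ∀ {n} → constV {n} 0# ≡ 0s
    0R≡0s {zero}  = refl
    0R≡0s {suc n} = refl

  1R⊗1R⊗ : (t : R) → 1R ⊗ 1R ⊗ t ≡ t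
  1R⊗1R⊗ t = trans (cong (_⊗ t) (⊗-identityˡ 1R)) (⊗-identityˡ t)

  -- In the certificates, each line is one monomial of the law, in the order of its definition:
  -- ⊕⁰ and ⊖⁰ drop a monomial shown to lie in the ideal, ⊕⁼ keeps it.
  lawX-≈ : ∀ {j} (a₁ a₂ a₃ a₄ a₆ x₁ z₁ x₂ z₂ : R) →
           x₁ ∈ε^ j → x₁ ∈ε^ 1 → x₂ ∈ε^ 1 → z₁ ∈ε^ suc j → z₂ ∈ε^ suc j →
           lawX a₁ a₂ a₃ a₄ a₆ x₁ 1R z₁ x₂ 1R z₂ ≈[ suc j ] x₂ ⊕ x₁
  lawX-≈ {j} a₁ a₂ a₃ a₄ a₆ x₁ z₁ x₂ z₂ x₁∈ʲ x₁∈ x₂∈ z₁∈ z₂∈ =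
    ≈-trans certificate (≡⇒≈ (cong₂ _⊕_
      (trans (⊕-identityˡ _) (trans (⊗-identityʳ _) (1R⊗1R⊗ x₂)))
      (trans (⊗-identityʳ _) (trans (⊗-identityʳ _) (⊗-identityʳ x₁)))))
    where
    certificate : lawX a₁ a₂ a₃ a₄ a₆ x₁ 1R z₁ x₂ 1R z₂
                    ≈[ suc j ] 0R ⊕ 1R ⊗ 1R ⊗ x₂ ⊗ 1R ⊕ x₁ ⊗ 1R ⊗ 1R ⊗ 1R
    certificate = ≈-refl {u = 0R}
        ⊕⁰ a₃ ⊗ a₄ ⊗ a₄ ⊗· z₁∈ ·⊗ z₁ ·⊗ z₂ ·⊗ z₂
        ⊖⁰ ι 4 ⊗ a₂ ⊗ a₃ ⊗ a₆ ⊗· z₁∈ ·⊗ z₁ ·⊗ z₂ ·⊗ z₂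
        ⊖⁰ a₂ ⊗ a₃ ⊗ a₃ ⊗ a₃ ⊗· z₁∈ ·⊗ z₁ ·⊗ z₂ ·⊗ z₂
        ⊕⁰ a₁ ⊗ a₃ ⊗ a₃ ⊗ a₄ ⊗· z₁∈ ·⊗ z₁ ·⊗ z₂ ·⊗ z₂
        ⊖⁰ a₁ ⊗ a₁ ⊗ a₃ ⊗ a₆ ⊗· z₁∈ ·⊗ z₁ ·⊗ z₂ ·⊗ z₂
        ⊕⁰ a₄ ⊗ a₄ ⊗· z₁∈ ·⊗ z₁ ·⊗ 1R ·⊗ z₂
        ⊖⁰ ι 4 ⊗ a₂ ⊗ a₆ ⊗· z₁∈ ·⊗ z₁ ·⊗ 1R ·⊗ z₂
        ⊖⁰ a₂ ⊗ a₃ ⊗ a₃ ⊗· z₁∈ ·⊗ z₁ ·⊗ 1R ·⊗ z₂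
        ⊕⁰ a₁ ⊗ a₃ ⊗ a₄ ⊗· z₁∈ ·⊗ z₁ ·⊗ 1R ·⊗ z₂
        ⊖⁰ a₁ ⊗ a₁ ⊗ a₆ ⊗· z₁∈ ·⊗ z₁ ·⊗ 1R ·⊗ z₂
        ⊖⁰ ι 3 ⊗ a₃ ⊗ a₆ ⊗· z₁∈ ·⊗ z₁ ·⊗ x₂ ·⊗ z₂
        ⊖⁰ a₃ ⊗ a₃ ⊗ a₃ ⊗· z₁∈ ·⊗ z₁ ·⊗ x₂ ·⊗ z₂
        ⊕⁰ a₁ ⊗ a₄ ⊗ a₄ ⊗· z₁∈ ·⊗ z₁ ·⊗ x₂ ·⊗ z₂
        ⊖⁰ ι 4 ⊗ a₁ ⊗ a₂ ⊗ a₆ ⊗· z₁∈ ·⊗ z₁ ·⊗ x₂ ·⊗ z₂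
        ⊖⁰ a₁ ⊗ a₂ ⊗ a₃ ⊗ a₃ ⊗· z₁∈ ·⊗ z₁ ·⊗ x₂ ·⊗ z₂
        ⊕⁰ a₁ ⊗ a₁ ⊗ a₃ ⊗ a₄ ⊗· z₁∈ ·⊗ z₁ ·⊗ x₂ ·⊗ z₂
        ⊖⁰ a₁ ⊗ a₁ ⊗ a₁ ⊗ a₆ ⊗· z₁∈ ·⊗ z₁ ·⊗ x₂ ·⊗ z₂
        ⊖⁰ ι 3 ⊗ a₆ ⊗· z₁∈ ·⊗ z₁ ·⊗ x₂ ·⊗ 1R
        ⊖⁰ a₃ ⊗ a₃ ⊗· z₁∈ ·⊗ z₁ ·⊗ x₂ ·⊗ 1R
        ⊖⁰ ι 3 ⊗ a₁ ⊗ a₆ ⊗· z₁∈ ·⊗ z₁ ·⊗ x₂ ·⊗ x₂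
        ⊖⁰ a₁ ⊗ a₃ ⊗ a₃ ⊗· z₁∈ ·⊗ z₁ ·⊗ x₂ ·⊗ x₂
        ⊕⁰ a₄ ⊗ a₄ ⊗ 1R ⊗· z₁∈ ·⊗ z₂ ·⊗ z₂
        ⊖⁰ ι 4 ⊗ a₂ ⊗ a₆ ⊗ 1R ⊗· z₁∈ ·⊗ z₂ ·⊗ z₂
        ⊖⁰ a₂ ⊗ a₃ ⊗ a₃ ⊗ 1R ⊗· z₁∈ ·⊗ z₂ ·⊗ z₂
        ⊕⁰ a₁ ⊗ a₃ ⊗ a₄ ⊗ 1R ⊗· z₁∈ ·⊗ z₂ ·⊗ z₂
        ⊖⁰ a₁ ⊗ a₁ ⊗ a₆ ⊗ 1R ⊗· z₁∈ ·⊗ z₂ ·⊗ z₂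
        ⊖⁰ ι 6 ⊗ a₆ ⊗ 1R ⊗· z₁∈ ·⊗ x₂ ·⊗ z₂
        ⊖⁰ ι 2 ⊗ a₃ ⊗ a₃ ⊗ 1R ⊗· z₁∈ ·⊗ x₂ ·⊗ z₂
        ⊖⁰ a₄ ⊗ 1R ⊗· z₁∈ ·⊗ x₂ ·⊗ x₂
        ⊖⁰ a₁ ⊗ a₃ ⊗ 1R ⊗· z₁∈ ·⊗ x₂ ·⊗ x₂
        ⊕⁼ 1R ⊗ 1R ⊗ x₂ ⊗ 1R
        ⊖⁰ ι 6 ⊗ a₃ ⊗ a₆ ⊗ x₁ ⊗· z₁∈ ·⊗ z₂ ·⊗ z₂
        ⊖⁰ a₃ ⊗ a₃ ⊗ a₃ ⊗ x₁ ⊗· z₁∈ ·⊗ z₂ ·⊗ z₂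
        ⊖⁰ ι 6 ⊗ a₆ ⊗ x₁ ⊗· z₁∈ ·⊗ 1R ·⊗ z₂
        ⊕⁰ a₃ ⊗ x₁ ⊗· z₁∈ ·⊗ 1R ·⊗ 1R
        ⊖⁰ ι 2 ⊗ a₃ ⊗ a₄ ⊗ x₁ ⊗· z₁∈ ·⊗ x₂ ·⊗ z₂
        ⊖⁰ ι 6 ⊗ a₁ ⊗ a₆ ⊗ x₁ ⊗· z₁∈ ·⊗ x₂ ·⊗ z₂
        ⊖⁰ ι 2 ⊗ a₁ ⊗ a₃ ⊗ a₃ ⊗ x₁ ⊗· z₁∈ ·⊗ x₂ ·⊗ z₂
        ⊖⁰ ι 2 ⊗ a₄ ⊗ x₁ ⊗· z₁∈ ·⊗ x₂ ·⊗ 1R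
        ⊖⁰ ι 2 ⊗ a₁ ⊗ a₄ ⊗ x₁ ⊗· z₁∈ ·⊗ x₂ ·⊗ x₂
        ⊖⁰ a₁ ⊗ a₁ ⊗ a₃ ⊗ x₁ ⊗· z₁∈ ·⊗ x₂ ·⊗ x₂
        ⊖⁰ ι 3 ⊗ a₆ ⊗ x₁ ⊗ 1R ⊗· z₂∈ ·⊗ z₂
        ⊕⁰ ι 2 ⊗ a₃ ⊗ x₁ ⊗ 1R ⊗ 1R ⊗· z₂∈
        ⊕⁼ x₁ ⊗ 1R ⊗ 1R ⊗ 1R
        ⊖⁰ ι 2 ⊗ a₄ ⊗ x₁ ⊗ 1R ⊗ x₂ ⊗· z₂∈
        ⊕⁰ ι 2 ⊗ a₁ ⊗· x₁∈ʲ ·⊗ 1R ·⊗· x₂∈ ·⊗ 1R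
        ⊖⁰ a₂ ⊗· x₁∈ʲ ·⊗ 1R ·⊗· x₂∈ ·⊗ x₂
        ⊖⁰ a₃ ⊗ a₄ ⊗ x₁ ⊗ x₁ ⊗· z₂∈ ·⊗ z₂
        ⊖⁰ a₄ ⊗ x₁ ⊗ x₁ ⊗ 1R ⊗· z₂∈
        ⊕⁰ a₁ ⊗ a₃ ⊗ x₁ ⊗ x₁ ⊗ 1R ⊗· z₂∈
        ⊕⁰ a₁ ⊗· x₁∈ʲ ·⊗· x₁∈ ·⊗ 1R ·⊗ 1R
        ⊖⁰ a₂ ⊗ a₃ ⊗ x₁ ⊗ x₁ ⊗ x₂ ⊗· z₂∈
        ⊖⁰ a₁ ⊗ a₄ ⊗ x₁ ⊗ x₁ ⊗ x₂ ⊗· z₂∈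
        ⊖⁰ a₂ ⊗· x₁∈ʲ ·⊗· x₁∈ ·⊗ x₂ ·⊗ 1R
        ⊕⁰ a₁ ⊗ a₁ ⊗· x₁∈ʲ ·⊗· x₁∈ ·⊗ x₂ ·⊗ 1R
        ⊖⁰ a₁ ⊗ a₂ ⊗· x₁∈ʲ ·⊗· x₁∈ ·⊗ x₂ ·⊗ x₂

  lawY-≈ : ∀ (a₁ a₂ a₃ a₄ a₆ x₁ z₁ x₂ z₂ : R) →
           x₁ ∈ε^ 1 → z₁ ∈ε^ 1 → x₂ ∈ε^ 1 → z₂ ∈ε^ 1 →
           lawY a₁ a₂ a₃ a₄ a₆ x₁ 1R z₁ x₂ 1R z₂ ≈[ 1 ] 1R
  lawY-≈ a₁ a₂ a₃ a₄ a₆ x₁ z₁ x₂ z₂ x₁∈ z₁∈ x₂∈ z₂∈ =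
    ≈-trans certificate (≡⇒≈ (trans (⊕-identityˡ _) (trans (⊗-identityʳ _) (1R⊗1R⊗ 1R))))
    where
    certificate : lawY a₁ a₂ a₃ a₄ a₆ x₁ 1R z₁ x₂ 1R z₂ ≈[ 1 ] 0R ⊕ 1R ⊗ 1R ⊗ 1R ⊗ 1R
    certificate = ≈-refl {u = 0R}
        ⊖⁰ ι 9 ⊗ a₆ ⊗ a₆ ⊗· z₁∈ ·⊗ z₁ ·⊗ z₂ ·⊗ z₂
        ⊖⁰ a₄ ⊗ a₄ ⊗ a₄ ⊗· z₁∈ ·⊗ z₁ ·⊗ z₂ ·⊗ z₂
        ⊖⁰ ι 6 ⊗ a₃ ⊗ a₃ ⊗ a₆ ⊗· z₁∈ ·⊗ z₁ ·⊗ z₂ ·⊗ z₂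
        ⊖⁰ a₃ ⊗ a₃ ⊗ a₃ ⊗ a₃ ⊗· z₁∈ ·⊗ z₁ ·⊗ z₂ ·⊗ z₂
        ⊕⁰ ι 4 ⊗ a₂ ⊗ a₄ ⊗ a₆ ⊗· z₁∈ ·⊗ z₁ ·⊗ z₂ ·⊗ z₂
        ⊕⁰ a₂ ⊗ a₃ ⊗ a₃ ⊗ a₄ ⊗· z₁∈ ·⊗ z₁ ·⊗ z₂ ·⊗ z₂
        ⊖⁰ ι 2 ⊗ a₁ ⊗ a₃ ⊗ a₄ ⊗ a₄ ⊗· z₁∈ ·⊗ z₁ ·⊗ z₂ ·⊗ z₂
        ⊕⁰ ι 4 ⊗ a₁ ⊗ a₂ ⊗ a₃ ⊗ a₆ ⊗· z₁∈ ·⊗ z₁ ·⊗ z₂ ·⊗ z₂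
        ⊕⁰ a₁ ⊗ a₂ ⊗ a₃ ⊗ a₃ ⊗ a₃ ⊗· z₁∈ ·⊗ z₁ ·⊗ z₂ ·⊗ z₂
        ⊕⁰ a₁ ⊗ a₁ ⊗ a₄ ⊗ a₆ ⊗· z₁∈ ·⊗ z₁ ·⊗ z₂ ·⊗ z₂
        ⊖⁰ a₁ ⊗ a₁ ⊗ a₃ ⊗ a₃ ⊗ a₄ ⊗· z₁∈ ·⊗ z₁ ·⊗ z₂ ·⊗ z₂
        ⊕⁰ a₁ ⊗ a₁ ⊗ a₁ ⊗ a₃ ⊗ a₆ ⊗· z₁∈ ·⊗ z₁ ·⊗ z₂ ·⊗ z₂
        ⊖⁰ ι 3 ⊗ a₃ ⊗ a₆ ⊗· z₁∈ ·⊗ z₁ ·⊗ 1R ·⊗ z₂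
        ⊖⁰ a₃ ⊗ a₃ ⊗ a₃ ⊗· z₁∈ ·⊗ z₁ ·⊗ 1R ·⊗ z₂
        ⊖⁰ a₁ ⊗ a₄ ⊗ a₄ ⊗· z₁∈ ·⊗ z₁ ·⊗ 1R ·⊗ z₂
        ⊕⁰ ι 4 ⊗ a₁ ⊗ a₂ ⊗ a₆ ⊗· z₁∈ ·⊗ z₁ ·⊗ 1R ·⊗ z₂
        ⊕⁰ a₁ ⊗ a₂ ⊗ a₃ ⊗ a₃ ⊗· z₁∈ ·⊗ z₁ ·⊗ 1R ·⊗ z₂
        ⊖⁰ a₁ ⊗ a₁ ⊗ a₃ ⊗ a₄ ⊗· z₁∈ ·⊗ z₁ ·⊗ 1R ·⊗ z₂
        ⊕⁰ a₁ ⊗ a₁ ⊗ a₁ ⊗ a₆ ⊗· z₁∈ ·⊗ z₁ ·⊗ 1R ·⊗ z₂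
        ⊖⁰ ι 3 ⊗ a₄ ⊗ a₆ ⊗· z₁∈ ·⊗ z₁ ·⊗ x₂ ·⊗ z₂
        ⊖⁰ a₃ ⊗ a₃ ⊗ a₄ ⊗· z₁∈ ·⊗ z₁ ·⊗ x₂ ·⊗ z₂
        ⊖⁰ a₂ ⊗ a₄ ⊗ a₄ ⊗· z₁∈ ·⊗ z₁ ·⊗ x₂ ·⊗ z₂
        ⊕⁰ ι 4 ⊗ a₂ ⊗ a₂ ⊗ a₆ ⊗· z₁∈ ·⊗ z₁ ·⊗ x₂ ·⊗ z₂
        ⊕⁰ a₂ ⊗ a₂ ⊗ a₃ ⊗ a₃ ⊗· z₁∈ ·⊗ z₁ ·⊗ x₂ ·⊗ z₂
        ⊖⁰ ι 3 ⊗ a₁ ⊗ a₃ ⊗ a₆ ⊗· z₁∈ ·⊗ z₁ ·⊗ x₂ ·⊗ z₂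
        ⊖⁰ a₁ ⊗ a₃ ⊗ a₃ ⊗ a₃ ⊗· z₁∈ ·⊗ z₁ ·⊗ x₂ ·⊗ z₂
        ⊖⁰ a₁ ⊗ a₂ ⊗ a₃ ⊗ a₄ ⊗· z₁∈ ·⊗ z₁ ·⊗ x₂ ·⊗ z₂
        ⊖⁰ a₁ ⊗ a₁ ⊗ a₄ ⊗ a₄ ⊗· z₁∈ ·⊗ z₁ ·⊗ x₂ ·⊗ z₂
        ⊕⁰ ι 5 ⊗ a₁ ⊗ a₁ ⊗ a₂ ⊗ a₆ ⊗· z₁∈ ·⊗ z₁ ·⊗ x₂ ·⊗ z₂
        ⊕⁰ a₁ ⊗ a₁ ⊗ a₂ ⊗ a₃ ⊗ a₃ ⊗· z₁∈ ·⊗ z₁ ·⊗ x₂ ·⊗ z₂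
        ⊖⁰ a₁ ⊗ a₁ ⊗ a₁ ⊗ a₃ ⊗ a₄ ⊗· z₁∈ ·⊗ z₁ ·⊗ x₂ ·⊗ z₂
        ⊕⁰ a₁ ⊗ a₁ ⊗ a₁ ⊗ a₁ ⊗ a₆ ⊗· z₁∈ ·⊗ z₁ ·⊗ x₂ ·⊗ z₂
        ⊖⁰ a₃ ⊗ a₄ ⊗· z₁∈ ·⊗ z₁ ·⊗ x₂ ·⊗ 1R
        ⊕⁰ ι 3 ⊗ a₁ ⊗ a₆ ⊗· z₁∈ ·⊗ z₁ ·⊗ x₂ ·⊗ 1R
        ⊖⁰ a₄ ⊗ a₄ ⊗· z₁∈ ·⊗ z₁ ·⊗ x₂ ·⊗ x₂
        ⊕⁰ ι 3 ⊗ a₂ ⊗ a₆ ⊗· z₁∈ ·⊗ z₁ ·⊗ x₂ ·⊗ x₂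
        ⊕⁰ a₂ ⊗ a₃ ⊗ a₃ ⊗· z₁∈ ·⊗ z₁ ·⊗ x₂ ·⊗ x₂
        ⊖⁰ ι 2 ⊗ a₁ ⊗ a₃ ⊗ a₄ ⊗· z₁∈ ·⊗ z₁ ·⊗ x₂ ·⊗ x₂
        ⊕⁰ ι 3 ⊗ a₁ ⊗ a₁ ⊗ a₆ ⊗· z₁∈ ·⊗ z₁ ·⊗ x₂ ·⊗ x₂
        ⊕⁰ a₃ ⊗ 1R ⊗· z₁∈ ·⊗ 1R ·⊗ 1R
        ⊕⁼ 1R ⊗ 1R ⊗ 1R ⊗ 1R
        ⊖⁰ ι 3 ⊗ a₄ ⊗ a₆ ⊗· x₁∈ ·⊗ z₁ ·⊗ z₂ ·⊗ z₂
        ⊖⁰ ι 2 ⊗ a₃ ⊗ a₃ ⊗ a₄ ⊗· x₁∈ ·⊗ z₁ ·⊗ z₂ ·⊗ z₂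
        ⊖⁰ a₂ ⊗ a₄ ⊗ a₄ ⊗· x₁∈ ·⊗ z₁ ·⊗ z₂ ·⊗ z₂
        ⊕⁰ ι 4 ⊗ a₂ ⊗ a₂ ⊗ a₆ ⊗· x₁∈ ·⊗ z₁ ·⊗ z₂ ·⊗ z₂
        ⊕⁰ a₂ ⊗ a₂ ⊗ a₃ ⊗ a₃ ⊗· x₁∈ ·⊗ z₁ ·⊗ z₂ ·⊗ z₂
        ⊕⁰ ι 3 ⊗ a₁ ⊗ a₃ ⊗ a₆ ⊗· x₁∈ ·⊗ z₁ ·⊗ z₂ ·⊗ z₂
        ⊖⁰ a₁ ⊗ a₂ ⊗ a₃ ⊗ a₄ ⊗· x₁∈ ·⊗ z₁ ·⊗ z₂ ·⊗ z₂
        ⊕⁰ a₁ ⊗ a₁ ⊗ a₂ ⊗ a₆ ⊗· x₁∈ ·⊗ z₁ ·⊗ z₂ ·⊗ z₂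
        ⊖⁰ ι 2 ⊗ a₃ ⊗ a₄ ⊗· x₁∈ ·⊗ z₁ ·⊗ 1R ·⊗ z₂
        ⊕⁰ ι 6 ⊗ a₁ ⊗ a₆ ⊗· x₁∈ ·⊗ z₁ ·⊗ 1R ·⊗ z₂
        ⊖⁰ ι 4 ⊗ a₄ ⊗ a₄ ⊗· x₁∈ ·⊗ z₁ ·⊗ x₂ ·⊗ z₂
        ⊕⁰ ι 12 ⊗ a₂ ⊗ a₆ ⊗· x₁∈ ·⊗ z₁ ·⊗ x₂ ·⊗ z₂
        ⊕⁰ ι 2 ⊗ a₂ ⊗ a₃ ⊗ a₃ ⊗· x₁∈ ·⊗ z₁ ·⊗ x₂ ·⊗ z₂
        ⊖⁰ ι 4 ⊗ a₁ ⊗ a₃ ⊗ a₄ ⊗· x₁∈ ·⊗ z₁ ·⊗ x₂ ·⊗ z₂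
        ⊕⁰ ι 6 ⊗ a₁ ⊗ a₁ ⊗ a₆ ⊗· x₁∈ ·⊗ z₁ ·⊗ x₂ ·⊗ z₂
        ⊖⁰ ι 2 ⊗ a₂ ⊗ a₃ ⊗· x₁∈ ·⊗ z₁ ·⊗ x₂ ·⊗ 1R
        ⊕⁰ ι 2 ⊗ a₁ ⊗ a₄ ⊗· x₁∈ ·⊗ z₁ ·⊗ x₂ ·⊗ 1R
        ⊕⁰ ι 9 ⊗ a₆ ⊗· x₁∈ ·⊗ z₁ ·⊗ x₂ ·⊗ x₂
        ⊕⁰ ι 3 ⊗ a₃ ⊗ a₃ ⊗· x₁∈ ·⊗ z₁ ·⊗ x₂ ·⊗ x₂
        ⊖⁰ a₂ ⊗ a₄ ⊗· x₁∈ ·⊗ z₁ ·⊗ x₂ ·⊗ x₂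
        ⊖⁰ ι 2 ⊗ a₁ ⊗ a₂ ⊗ a₃ ⊗· x₁∈ ·⊗ z₁ ·⊗ x₂ ·⊗ x₂
        ⊕⁰ a₁ ⊗ a₁ ⊗ a₄ ⊗· x₁∈ ·⊗ z₁ ·⊗ x₂ ·⊗ x₂
        ⊕⁰ a₁ ⊗· x₁∈ ·⊗ 1R ·⊗ 1R ·⊗ 1R
        ⊖⁰ a₄ ⊗ a₄ ⊗· x₁∈ ·⊗ x₁ ·⊗ z₂ ·⊗ z₂
        ⊕⁰ ι 3 ⊗ a₂ ⊗ a₆ ⊗· x₁∈ ·⊗ x₁ ·⊗ z₂ ·⊗ z₂
        ⊖⁰ a₂ ⊗ a₃ ⊗· x₁∈ ·⊗ x₁ ·⊗ 1R ·⊗ z₂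
        ⊕⁰ a₁ ⊗ a₄ ⊗· x₁∈ ·⊗ x₁ ·⊗ 1R ·⊗ z₂
        ⊕⁰ ι 9 ⊗ a₆ ⊗· x₁∈ ·⊗ x₁ ·⊗ x₂ ·⊗ z₂
        ⊖⁰ a₂ ⊗ a₄ ⊗· x₁∈ ·⊗ x₁ ·⊗ x₂ ·⊗ z₂
        ⊖⁰ ι 3 ⊗ a₃ ⊗· x₁∈ ·⊗ x₁ ·⊗ x₂ ·⊗ 1R
        ⊕⁰ a₁ ⊗ a₂ ⊗· x₁∈ ·⊗ x₁ ·⊗ x₂ ·⊗ 1R
        ⊕⁰ ι 3 ⊗ a₄ ⊗· x₁∈ ·⊗ x₁ ·⊗ x₂ ·⊗ x₂
        ⊖⁰ a₂ ⊗ a₂ ⊗· x₁∈ ·⊗ x₁ ·⊗ x₂ ·⊗ x₂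

  module _ (E : Curve) where
    open Curve E
    open Einf

    onCurve-z-∈ε^-suc : ∀ {j x z} → OnCurve E x 1R z → x ∈ε^ 1 → z ∈ε^ 1 →
                        x ∈ε^ j → z ∈ε^ j → z ∈ε^ suc j
    onCurve-z-∈ε^-suc {j} {x} {z} on-curve x∈ z∈ x∈ʲ z∈ʲ = subst (_∈ε^ suc j) (1R⊗1R⊗ z) z∈ʲ⁺¹
      where
      rhs∈ : x ⊗ x ⊗ x ⊕ a₂ ⊗ x ⊗ x ⊗ z ⊕ a₄ ⊗ x ⊗ z ⊗ z ⊕ a₆ ⊗ z ⊗ z ⊗ z ∈ε^ suc j
      rhs∈ = ⊕-∈ε^ (⊕-∈ε^ (⊕-∈ε^ (x∈ʲ ·⊗· x∈ ·⊗ x) (a₂ ⊗· x∈ʲ ·⊗· x∈ ·⊗ z))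
                          (a₄ ⊗· x∈ʲ ·⊗· z∈ ·⊗ z))
                   (a₆ ⊗· z∈ʲ ·⊗· z∈ ·⊗ z)
      lhs∈ : 1R ⊗ 1R ⊗ z ⊕ a₁ ⊗ x ⊗ 1R ⊗ z ⊕ a₃ ⊗ 1R ⊗ z ⊗ z ∈ε^ suc j
      lhs∈ = subst (_∈ε^ suc j) (sym on-curve) rhs∈
      z∈ʲ⁺¹ : 1R ⊗ 1R ⊗ z ∈ε^ suc j
      z∈ʲ⁺¹ = ⊕-cancelʳ-∈ε^ (⊕-cancelʳ-∈ε^ lhs∈ (a₃ ⊗ 1R ⊗· z∈ʲ ·⊗· z∈)) (a₁ ⊗· x∈ʲ ·⊗ 1R ·⊗· z∈)

    Px-∈ε : (P : Einf E) → Px P ∈ε^ 1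
    Px-∈ε P = ε∣R⇒∈ε^1 (Px∈ε P)

    Pz-∈ε : (P : Einf E) → Pz P ∈ε^ 1
    Pz-∈ε P = ε∣R⇒∈ε^1 (Pz∈ε P)

    Pz-∈ε^-suc : ∀ m (P : Einf E) → Px P ∈ε^ m → Pz P ∈ε^ suc m
    Pz-∈ε^-suc zero    P _  = Pz-∈ε P
    Pz-∈ε^-suc (suc m) P x∈ =
      onCurve-z-∈ε^-suc (onCurve P) (Px-∈ε P) (Pz-∈ε P) x∈ (Pz-∈ε^-suc m P (≈-pred x∈))

    sumX-≈ : ∀ {m} (P Q : Einf E) → Px P ∈ε^ m → Px Q ∈ε^ m → sumX E P Q ≈[ suc m ] Px Q ⊕ Px P
    sumX-≈ {m} P Q xP∈ xQ∈ = begin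
      X₃ ⊗ invR Y₃            ≈⟨ ⊗-cong X₃≈ ≈-refl ⟩
      (Px Q ⊕ Px P) ⊗ invR Y₃ ≈⟨ ≈-cast (ℕₚ.+-comm m 1) (⊗-congʳ-∈ε^ (⊕-∈ε^ xQ∈ xP∈) (invR-≈1 Y₃ Y₃≈1)) ⟩
      (Px Q ⊕ Px P) ⊗ 1R      ≡⟨ ⊗-identityʳ _ ⟩
      Px Q ⊕ Px P             ∎
      where
      open SetoidReasoning (≈-setoid (suc m))
      X₃ Y₃ : R
      X₃ = lawX a₁ a₂ a₃ a₄ a₆ (Px P) 1R (Pz P) (Px Q) 1R (Pz Q)
      Y₃ = lawY a₁ a₂ a₃ a₄ a₆ (Px P) 1R (Pz P) (Px Q) 1R (Pz Q)
      X₃≈ : X₃ ≈[ suc m ] Px Q ⊕ Px P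
      X₃≈ = lawX-≈ a₁ a₂ a₃ a₄ a₆ (Px P) (Pz P) (Px Q) (Pz Q) xP∈ (Px-∈ε P) (Px-∈ε Q)
                   (Pz-∈ε^-suc m P xP∈) (Pz-∈ε^-suc m Q xQ∈)
      Y₃≈1 : Y₃ ≈[ 1 ] 1R
      Y₃≈1 = lawY-≈ a₁ a₂ a₃ a₄ a₆ (Px P) (Pz P) (Px Q) (Pz Q)
                    (Px-∈ε P) (Pz-∈ε P) (Px-∈ε Q) (Pz-∈ε Q)

open FiniteField using (Carrier; _+_)

mainTheorem17 : (𝔽 : FiniteField) (k : ℕ) → 1 ≤ k → let open TruncPoly 𝔽 k in
    (E : Curve) (P Q : Einf E) (m : ℕ) (cP cQ : Carrier 𝔽) →
    HasValuation (Einf.Px P) m →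
    HasValuation (Einf.Px Q) m →
    Einf.Px P ≡ const cP ⊗ (ε^ m) [mod-ε^ suc m ] →
    Einf.Px Q ≡ const cQ ⊗ (ε^ m) [mod-ε^ suc m ] →
    sumX E P Q ≡ const (_+_ 𝔽 cP cQ) ⊗ (ε^ m) [mod-ε^ suc m ]
mainTheorem17 𝔽 k _ E P Q m cP cQ _ _ Px≡ Qx≡ = ≈⇒mod (begin
    sumX E P Q                        ≈⟨ sumX-≈ E P Q (≈const⊗ε^⇒∈ε^ Px≈) (≈const⊗ε^⇒∈ε^ Qx≈) ⟩
    Px Q ⊕ Px P                       ≈⟨ ⊕-cong Qx≈ Px≈ ⟩
    const cQ ⊗ ε^ m ⊕ const cP ⊗ ε^ m ≡⟨ const-+-⊗ cP cQ (ε^ m) ⟩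
    const (_+_ 𝔽 cP cQ) ⊗ ε^ m        ∎)
  where
  open TruncPoly 𝔽 k
  open TruncPolyProperties 𝔽 k
  open SetoidReasoning (≈-setoid (suc m))
  open Einf
  Px≈ : Px P ≈[ suc m ] const cP ⊗ ε^ m
  Px≈ = mod⇒≈ Px≡
  Qx≈ : Px Q ≈[ suc m ] const cQ ⊗ ε^ m
  Qx≈ = mod⇒≈ Qx≡
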